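{- Let $t\ge 1$ and $s$ be integers. If $0<t-s<2t$, then $F(2t,2t,2s)=F(2t,2t,2s-1)=f(2t,t-s)$. If $0<t-s<2t+1$, then $F(2t+1,2t+1,2s)=F(2t+1,2t+1,2s+1)=f(2t+1,t-s)$.
   Context: $F(n,k,l)$ is the maximum size of a family $\mathcal V$ of vectors in $\{0,\pm1\}^n$, each with exactly $k$ nonzero coordinates, such that $\langle\mathbf v,\mathbf w\rangle\ge l$ for all $\mathbf v,\mathbf w\in\mathcal V$ (standard scalar product). For integers $n>r>0$, $f(n,r)=\sum_{i=0}^{r/2}\binom{n}{i}$ if $r$ is even and $f(n,r)=2\sum_{i=0}^{(r-1)/2}\binom{n-1}{i}$ if $r$ is odd. -}

module Defs where

open import Data.Nat as ℕ using (ℕ; zero; suc; _≤_; _∸_; _%_; _/_)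
open import Data.Nat.Combinatorics using (_C_)
open import Data.Integer as ℤ using (ℤ; +_; -[1+_]; 0ℤ; 1ℤ; -1ℤ)
open import Data.Vec using (Vec; []; _∷_)
open import Data.List using (List; length)
open import Data.List.Relation.Unary.All using (All)
open import Data.List.Relation.Unary.Unique.Propositional using (Unique)
open import Data.Product using (_×_)
open import Relation.Binary.PropositionalEquality using (_≡_)

data Trit : Set where
  neg zer pos : Trit

val : Trit → ℤ
val neg = -1ℤ
val zer = 0ℤ
val pos = 1ℤ

weight : ∀ {n} → Vec Trit n → ℕ
weight [] = 0
weight (zer ∷ v) = weight v
weight (neg ∷ v) = suc (weight v)
weight (pos ∷ v) = suc (weight v)

dot : ∀ {n} → Vec Trit n → Vec Trit n → ℤ
dot [] [] = 0ℤ
dot (a ∷ v) (b ∷ w) = val a ℤ.* val b ℤ.+ dot v w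

Admissible : (n k : ℕ) (l : ℤ) → List (Vec Trit n) → Set
Admissible n k l V =
  Unique V ×
  All (λ v → weight v ≡ k) V ×
  All (λ v → All (λ w → l ℤ.≤ dot v w) V) V

-- "F(n,k,l) = m": m is the maximum size of an admissible family.
IsF : (n k : ℕ) (l : ℤ) (m : ℕ) → Set
IsF n k l m =
  (Data.Product.Σ (List (Vec Trit n)) λ V → Admissible n k l V × length V ≡ m) ×
  (∀ (V : List (Vec Trit n)) → Admissible n k l V → length V ≤ m)

sumC : ℕ → ℕ → ℕ
sumC n zero = n C 0
sumC n (suc m) = sumC n m ℕ.+ n C suc m

-- f(n,r): r even ↦ Σ_{i≤r/2} C(n,i);  r odd ↦ 2 Σ_{i≤(r-1)/2} C(n-1,i)
-- (for odd r, (r-1)/2 = ⌊r/2⌋).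
f : ℕ → ℕ → ℕ
f n r with r % 2
... | zero = sumC n (r / 2)
... | suc _ = 2 ℕ.* sumC (n ∸ 1) (r / 2)

-- A vector of {0,±1}ⁿ with n nonzero coordinates is a ±1 vector, i.e. a point x of the cube {0,1}ⁿ,
-- and ⟨v,w⟩ = n − 2·d(x,y) for the Hamming distance d. Both halves of the proposition therefore say
-- F(n,n,n−2r−e) = f(n,r) for e ∈ {0,1}, which is Kleitman's diameter theorem: a family in {0,1}ⁿ of
-- diameter at most r < n has at most f(n,r) members, with equality for a Hamming ball (r even) or a
-- ball of one dimension less times {0,1} (r odd).
-- For the upper bound, clearing a coordinate of x whenever the result is not yet in the family keeps
-- size and diameter and ends in a down-closed family, where |x ∪ y| = d(x, y ∖ x) ≤ r. Katona's theorem
-- bounds such families by induction on n: once no member can move its first 1 into a free coordinate,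
-- the members starting with 1 have pairwise unions ≤ r − 2 on the remaining coordinates, and
-- f(n,r) + f(n,r−2) = f(n+1,r) closes the induction; for r = n − 1 a family and its complements are
-- disjoint, so it has at most 2ⁿ⁻¹ = f(n,n−1) members.
module Submission where

open import Defs
open import Data.Bool as Bool using (Bool; true; false; not; _∧_; _∨_; _xor_; if_then_else_; f≤t; b≤b)
open import Data.Bool.Properties
  using (∨-comm; xor-comm; xor-same; ∨-inverseʳ; not-involutive) renaming (_≟_ to _≟ᵇ_)
open import Data.Empty using (⊥-elim)
open import Data.Fin using (Fin; zero; suc)
import Data.Fin.Properties as Fin
open import Data.Integer as ℤ using (ℤ; +_; _⊖_; 1ℤ; -1ℤ)
import Data.Integer.Properties as ℤ
import Data.Integer.Tactic.RingSolver as ℤ-Ring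
open import Data.List using (List; []; _∷_; length; map; _++_)
open import Data.List.Membership.Propositional using (_∈_; _∉_; find)
open import Data.List.Membership.Propositional.Properties using (∈-map⁻; ∈-++⁻)
open import Data.List.Properties using (length-map; length-++; map-∘)
open import Data.List.Relation.Binary.Disjoint.Propositional using (Disjoint)
open import Data.List.Relation.Unary.All as All using (All)
import Data.List.Relation.Unary.All.Properties as All
open import Data.List.Relation.Unary.Any using (here; there)
open import Data.List.Relation.Unary.Unique.Propositional using (Unique; []; _∷_)
import Data.List.Relation.Unary.Unique.Propositional.Properties as Unique
open import Data.Nat as ℕ using (ℕ; zero; suc; _+_; _*_; _∸_; _^_; _≤_; _<_; _≤?_; z≤n; s≤s)
open import Data.Nat.Combinatorics using (_C_; nCk+nC[k+1]≡[n+1]C[k+1]; nCk≡nC[n∸k])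
open import Data.Nat.DivMod using (_/_; _%_; m*n%n≡0; m*n/n≡m; [m+kn]%n≡m%n; +-distrib-/)
open import Data.Nat.Induction using (<-wellFounded)
open import Data.Nat.ListAction using (sum)
open import Data.Nat.Properties
import Data.Nat.Tactic.RingSolver as ℕ-Ring
open import Data.Product using (Σ-syntax; ∃; ∃₂; _×_; _,_)
open import Data.Sum using (_⊎_; inj₁; inj₂)
open import Data.Vec as Vec using (Vec; []; _∷_; lookup; _[_]≔_)
open import Data.Vec.Properties using (≡-dec; ∷-injectiveʳ; lookup∘update; []≔-idempotent; []≔-lookup)
open import Data.Vec.Relation.Binary.Pointwise.Inductive using (Pointwise; []; _∷_)
open import Function using (_∘_)
open import Function.Bundles using (_⇔_; mk⇔; Equivalence)
open import Induction.WellFounded using (Acc; acc)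
open import Relation.Binary.Definitions using (DecidableEquality)
open import Relation.Binary.PropositionalEquality
open import Relation.Nullary using (yes; no)

private
  variable
    n d k : ℕ

-- The Boolean cube

bit : Bool → ℕ
bit false = 0
bit true = 1

ones : Vec Bool n → ℕ
ones [] = 0
ones (a ∷ x) = bit a + ones x

distance : Vec Bool n → Vec Bool n → ℕ
distance [] [] = 0
distance (a ∷ x) (b ∷ y) = bit (a xor b) + distance x y

unionSize : Vec Bool n → Vec Bool n → ℕ
unionSize [] [] = 0
unionSize (a ∷ x) (b ∷ y) = bit (a ∨ b) + unionSize x y

DistanceAtMost UnionAtMost : ℕ → Vec Bool n → Vec Bool n → Set
DistanceAtMost d x y = distance x y ≤ d
UnionAtMost d x y = unionSize x y ≤ d

distance-comm : (x y : Vec Bool n) → distance x y ≡ distance y x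
distance-comm [] [] = refl
distance-comm (a ∷ x) (b ∷ y) = cong₂ _+_ (cong bit (xor-comm a b)) (distance-comm x y)

unionSize-comm : (x y : Vec Bool n) → unionSize x y ≡ unionSize y x
unionSize-comm [] [] = refl
unionSize-comm (a ∷ x) (b ∷ y) = cong₂ _+_ (cong bit (∨-comm a b)) (unionSize-comm x y)

[]≔-restore : ∀ {A : Set} (x : Vec A n) i {a b} → lookup x i ≡ a → (x [ i ]≔ b) [ i ]≔ a ≡ x
[]≔-restore x i {a} refl = trans ([]≔-idempotent x i) ([]≔-lookup x i)

-- Compressions

Clique : {A : Set} → (A → A → Set) → List A → Set
Clique R F = ∀ {x y} → x ∈ F → y ∈ F → R x y

unique-map⁺ : ∀ {A B : Set} (g : A → B) {xs : List A} →
  (∀ {x y} → x ∈ xs → y ∈ xs → g x ≡ g y → x ≡ y) → Unique xs → Unique (map g xs)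
unique-map⁺ g {[]} injective [] = []
unique-map⁺ g {x ∷ xs} injective (x∉xs ∷ u) =
  All.map⁺ (All.tabulate λ y∈ gx≡gy → All.lookup x∉xs y∈ (injective (here refl) (there y∈) gx≡gy))
  ∷ unique-map⁺ g (λ x∈ y∈ → injective (there x∈) (there y∈)) u

sum-map-< : ∀ {A : Set} (g h : A → ℕ) {xs : List A} → (∀ {x} → x ∈ xs → g x ≤ h x) →
  ∀ {x₀} → x₀ ∈ xs → g x₀ < h x₀ → sum (map g xs) < sum (map h xs)
sum-map-< g h {x ∷ xs} g≤h (here refl) g<h = +-mono-<-≤ g<h (sum-map-≤ xs (g≤h ∘ there))
  where
  sum-map-≤ : ∀ xs → (∀ {x} → x ∈ xs → g x ≤ h x) → sum (map g xs) ≤ sum (map h xs)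
  sum-map-≤ [] _ = z≤n
  sum-map-≤ (x ∷ xs) g≤h = +-mono-≤ (g≤h (here refl)) (sum-map-≤ xs (g≤h ∘ there))
sum-map-< g h {x ∷ xs} g≤h (there x₀∈) g<h =
  +-mono-≤-< (g≤h (here refl)) (sum-map-< g h (g≤h ∘ there) x₀∈ g<h)

module Compression {A : Set} (_≟_ : DecidableEquality A) {k : ℕ} (φ : Fin k → A → A)
  (φ-injective-on-moved : ∀ i {x y} → φ i x ≡ φ i y → φ i x ≢ x → φ i y ≢ y → x ≡ y)
  (μ : A → ℕ) (μ-decreasing : ∀ i x → φ i x ≢ x → μ (φ i x) < μ x)
  where

  open import Data.List.Membership.DecPropositional _≟_ using (_∈?_)

  compressor : Fin k → List A → A → A
  compressor i F x with φ i x ∈? F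
  ... | yes _ = x
  ... | no _ = φ i x

  compress : Fin k → List A → List A
  compress i F = map (compressor i F) F

  Stable : List A → Set
  Stable F = ∀ i → All (λ x → φ i x ∈ F) F

  private
    compressor-cases : ∀ i F x →
      (φ i x ∈ F × compressor i F x ≡ x) ⊎ (φ i x ∉ F × compressor i F x ≡ φ i x)
    compressor-cases i F x with φ i x ∈? F
    ... | yes φx∈ = inj₁ (φx∈ , refl)
    ... | no φx∉ = inj₂ (φx∉ , refl)

    moved : ∀ {i F x} → x ∈ F → φ i x ∉ F → φ i x ≢ x
    moved x∈ φx∉ φx≡x = φx∉ (subst (_∈ _) (sym φx≡x) x∈)

    stable? : ∀ F → Stable F ⊎ ∃₂ λ i x → x ∈ F × φ i x ∉ F
    stable? F with Fin.all? (λ i → All.all? (λ x → φ i x ∈? F) F)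
    ... | yes stable = inj₁ stable
    ... | no ¬stable with Fin.¬∀⟶∃¬ k _ (λ i → All.all? (λ x → φ i x ∈? F) F) ¬stable
    ...   | i , ¬all with find (All.¬All⇒Any¬ (λ x → φ i x ∈? F) F ¬all)
    ...     | x , x∈ , φx∉ = inj₂ (i , x , x∈ , φx∉)

    compress-unique : ∀ i F → Unique F → Unique (compress i F)
    compress-unique i F = unique-map⁺ (compressor i F) injective
      where
      injective : ∀ {x y} → x ∈ F → y ∈ F → compressor i F x ≡ compressor i F y → x ≡ y
      injective {x} {y} x∈ y∈ cx≡cy with compressor-cases i F x | compressor-cases i F y
      ... | inj₁ (_ , cx≡x) | inj₁ (_ , cy≡y) = trans (sym cx≡x) (trans cx≡cy cy≡y)
      ... | inj₁ (_ , cx≡x) | inj₂ (φy∉ , cy≡φy) =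
        ⊥-elim (φy∉ (subst (_∈ F) (trans (sym cx≡x) (trans cx≡cy cy≡φy)) x∈))
      ... | inj₂ (φx∉ , cx≡φx) | inj₁ (_ , cy≡y) =
        ⊥-elim (φx∉ (subst (_∈ F) (trans (sym cy≡y) (trans (sym cx≡cy) cx≡φx)) y∈))
      ... | inj₂ (φx∉ , cx≡φx) | inj₂ (φy∉ , cy≡φy) =
        φ-injective-on-moved i (trans (sym cx≡φx) (trans cx≡cy cy≡φy)) (moved x∈ φx∉) (moved y∈ φy∉)

    total : List A → ℕ
    total F = sum (map μ F)

    compress-total-< : ∀ i F {x₀} → x₀ ∈ F → φ i x₀ ∉ F → total (compress i F) < total F
    compress-total-< i F x₀∈ φx₀∉ =
      subst (_< total F) (cong sum (map-∘ F))
        (sum-map-< (μ ∘ compressor i F) μ μc≤μ x₀∈ (μc<μ x₀∈ φx₀∉))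
      where
      μc≤μ : ∀ {x} → x ∈ F → μ (compressor i F x) ≤ μ x
      μc≤μ {x} x∈ with compressor-cases i F x
      ... | inj₁ (_ , cx≡x) = ≤-reflexive (cong μ cx≡x)
      ... | inj₂ (φx∉ , cx≡φx) = subst (λ z → μ z ≤ μ x) (sym cx≡φx)
        (<⇒≤ (μ-decreasing i x (moved x∈ φx∉)))
      μc<μ : ∀ {x} → x ∈ F → φ i x ∉ F → μ (compressor i F x) < μ x
      μc<μ {x} x∈ φx∉ with compressor-cases i F x
      ... | inj₁ (φx∈ , _) = ⊥-elim (φx∉ φx∈)
      ... | inj₂ (_ , cx≡φx) = subst (λ z → μ z < μ x) (sym cx≡φx) (μ-decreasing i x (moved x∈ φx∉))

  module _ (R : A → A → Set) (R-sym : ∀ {x y} → R x y → R y x)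
    (moved-moved : ∀ i {x y} → φ i x ≢ x → φ i y ≢ y → R x y → R (φ i x) (φ i y))
    (moved-fixed : ∀ i {x y} → φ i x ≢ x → R x y → R x (φ i y) → R (φ i x) y)
    where

    compress-clique : ∀ i F → Clique R F → Clique R (compress i F)
    compress-clique i F cF u∈ v∈ with ∈-map⁻ (compressor i F) u∈ | ∈-map⁻ (compressor i F) v∈
    ... | x , x∈ , refl | y , y∈ , refl with compressor-cases i F x | compressor-cases i F y
    ... | inj₁ (_ , cx≡x) | inj₁ (_ , cy≡y) =
      subst₂ R (sym cx≡x) (sym cy≡y) (cF x∈ y∈)
    ... | inj₂ (φx∉ , cx≡φx) | inj₂ (φy∉ , cy≡φy) =
      subst₂ R (sym cx≡φx) (sym cy≡φy) (moved-moved i (moved x∈ φx∉) (moved y∈ φy∉) (cF x∈ y∈))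
    ... | inj₂ (φx∉ , cx≡φx) | inj₁ (φy∈ , cy≡y) =
      subst₂ R (sym cx≡φx) (sym cy≡y) (moved-fixed i (moved x∈ φx∉) (cF x∈ y∈) (cF x∈ φy∈))
    ... | inj₁ (φx∈ , cx≡x) | inj₂ (φy∉ , cy≡φy) =
      subst₂ R (sym cx≡x) (sym cy≡φy) (R-sym (moved-fixed i (moved y∈ φy∉) (cF y∈ x∈) (cF y∈ φx∈)))

    stabilise : ∀ F → Unique F → Clique R F →
      Σ[ G ∈ List A ] Stable G × Unique G × Clique R G × length G ≡ length F
    stabilise F = go F (<-wellFounded (total F))
      where
      go : ∀ F → Acc _<_ (total F) → Unique F → Clique R F →
        Σ[ G ∈ List A ] Stable G × Unique G × Clique R G × length G ≡ length F
      go F (acc smaller) uF cF with stable? F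
      ... | inj₁ stable = F , stable , uF , cF , refl
      ... | inj₂ (i , x , x∈ , φx∉) =
        let G , stable , uG , cG , |G|≡ = go (compress i F) (smaller (compress-total-< i F x∈ φx∉))
                                             (compress-unique i F uF) (compress-clique i F cF)
        in G , stable , uG , cG , trans |G|≡ (length-map (compressor i F) F)

-- Binomial sums

data Parity : ℕ → Set where
  even : ∀ m → Parity (m * 2)
  odd : ∀ m → Parity (suc (m * 2))

parity : ∀ d → Parity d
parity zero = even 0
parity (suc d) with parity d
... | even m = odd m
... | odd m = even (suc m)

m*2≡m+m : ∀ m → m * 2 ≡ m + m
m*2≡m+m m = trans (*-suc m 1) (cong (_+_ m) (*-identityʳ m))

m*2%2≡0 : ∀ m → m * 2 % 2 ≡ 0
m*2%2≡0 m = m*n%n≡0 m 2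

m*2/2≡m : ∀ m → m * 2 / 2 ≡ m
m*2/2≡m m = m*n/n≡m m 2

[1+m*2]%2≡1 : ∀ m → suc (m * 2) % 2 ≡ 1
[1+m*2]%2≡1 m = [m+kn]%n≡m%n 1 m 2

[1+m*2]/2≡m : ∀ m → suc (m * 2) / 2 ≡ m
[1+m*2]/2≡m m = trans (+-distrib-/ 1 (m * 2) (subst (λ r → 1 + r < 2) (sym (m*2%2≡0 m)) ≤-refl))
                      (m*2/2≡m m)

f-even : ∀ n m → f n (m * 2) ≡ sumC n m
f-even n m rewrite m*2%2≡0 m | m*2/2≡m m = refl

f-odd : ∀ n m → f n (suc (m * 2)) ≡ 2 * sumC (n ∸ 1) m
f-odd n m rewrite [1+m*2]%2≡1 m | [1+m*2]/2≡m m = refl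

sumC-pascal : ∀ n k → sumC (suc n) (suc k) ≡ sumC n (suc k) + sumC n k
sumC-pascal n zero = trans (cong suc (sym (nCk+nC[k+1]≡[n+1]C[k+1] n 0))) (+-comm 1 (1 + n C 1))
sumC-pascal n (suc k) = begin
  sumC (suc n) (suc k) + suc n C suc (suc k)
    ≡⟨ cong₂ _+_ (sumC-pascal n k) (sym (nCk+nC[k+1]≡[n+1]C[k+1] n (suc k))) ⟩
  (sumC n (suc k) + sumC n k) + (n C suc k + n C suc (suc k))
    ≡⟨ regroup (sumC n (suc k)) (sumC n k) (n C suc k) (n C suc (suc k)) ⟩
  (sumC n (suc k) + n C suc (suc k)) + (sumC n k + n C suc k) ∎
  where
  open ≡-Reasoning
  regroup : ∀ a b c d → (a + b) + (c + d) ≡ (a + d) + (b + c)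
  regroup = ℕ-Ring.solve-∀

sumC-doubling : ∀ n k → sumC (suc n) k + n C k ≡ 2 * sumC n k
sumC-doubling n zero = refl
sumC-doubling n (suc k) = begin
  sumC (suc n) (suc k) + n C suc k       ≡⟨ cong (_+ n C suc k) (sumC-pascal n k) ⟩
  sumC n (suc k) + sumC n k + n C suc k  ≡⟨ +-assoc (sumC n (suc k)) _ _ ⟩
  sumC n (suc k) + sumC n (suc k)        ≡⟨ cong (_+_ (sumC n (suc k))) (sym (+-identityʳ _)) ⟩
  2 * sumC n (suc k)                     ∎
  where open ≡-Reasoning

-- Pascal's rule twice and C(2m+1, m+1) = C(2m+1, m) give Σ_{i≤m+1} C(2m+3, i) = 4 Σ_{i≤m} C(2m+1, i).
sumC-central : ∀ m → sumC (suc (m * 2)) m ≡ 2 ^ (m * 2)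
sumC-central zero = refl
sumC-central (suc m) = begin
  sumC (2 + N) (suc m)     ≡⟨ +-cancelʳ-≡ c _ _ quadruple ⟩
  4 * S                    ≡⟨ cong (4 *_) (sumC-central m) ⟩
  4 * 2 ^ (m * 2)          ≡⟨ *-assoc 2 2 (2 ^ (m * 2)) ⟩
  2 ^ (suc m * 2)          ∎
  where
  open ≡-Reasoning
  N = suc (m * 2)
  S = sumC N m
  c = N C m
  N≡1+m+m : N ≡ suc m + m
  N≡1+m+m = cong suc (m*2≡m+m m)
  symmetric : N C suc m ≡ c
  symmetric = sym (begin
    N C m              ≡⟨ nCk≡nC[n∸k] (subst (m ≤_) (sym N≡1+m+m) (m≤n+m m (suc m))) ⟩
    N C (N ∸ m)        ≡⟨ cong (λ k → N C (k ∸ m)) N≡1+m+m ⟩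
    N C (suc m + m ∸ m) ≡⟨ cong (N C_) (m+n∸n≡m (suc m) m) ⟩
    N C suc m          ∎)
  quadruple : sumC (2 + N) (suc m) + c ≡ 4 * S + c
  quadruple = begin
    sumC (2 + N) (suc m) + c                 ≡⟨ cong (_+ c) (sumC-pascal (suc N) m) ⟩
    sumC (suc N) (suc m) + sumC (suc N) m + c ≡⟨ +-assoc (sumC (suc N) (suc m)) _ c ⟩
    sumC (suc N) (suc m) + (sumC (suc N) m + c) ≡⟨ cong₂ _+_ (sumC-pascal N m) (sumC-doubling N m) ⟩
    (S + N C suc m) + S + 2 * S              ≡⟨ cong (λ c′ → (S + c′) + S + 2 * S) symmetric ⟩
    (S + c) + S + 2 * S                      ≡⟨ collect S c ⟩
    4 * S + c                                ∎
    where
    collect : ∀ S c → (S + c) + S + 2 * S ≡ 4 * S + c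
    collect = ℕ-Ring.solve-∀

f-pascal : ∀ {n} d → 0 < n → f n (2 + d) + f n d ≡ f (suc n) (2 + d)
f-pascal {suc n} d _ with parity d
... | even m = begin
  f (suc n) (suc m * 2) + f (suc n) (m * 2)   ≡⟨ cong₂ _+_ (f-even (suc n) (suc m)) (f-even (suc n) m) ⟩
  sumC (suc n) (suc m) + sumC (suc n) m       ≡⟨ sym (sumC-pascal (suc n) m) ⟩
  sumC (2 + n) (suc m)                        ≡⟨ sym (f-even (2 + n) (suc m)) ⟩
  f (2 + n) (suc m * 2)                       ∎
  where open ≡-Reasoning
... | odd m = begin
  f (suc n) (suc (suc m * 2)) + f (suc n) (suc (m * 2))
    ≡⟨ cong₂ _+_ (f-odd (suc n) (suc m)) (f-odd (suc n) m) ⟩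
  2 * sumC n (suc m) + 2 * sumC n m   ≡⟨ sym (*-distribˡ-+ 2 (sumC n (suc m)) _) ⟩
  2 * (sumC n (suc m) + sumC n m)     ≡⟨ cong (2 *_) (sym (sumC-pascal n m)) ⟩
  2 * sumC (suc n) (suc m)            ≡⟨ sym (f-odd (2 + n) (suc m)) ⟩
  f (2 + n) (suc (suc m * 2))         ∎
  where open ≡-Reasoning

f-diagonal : ∀ n → f (suc n) n ≡ 2 ^ n
f-diagonal n with parity n
... | even m = trans (f-even (suc (m * 2)) m) (sumC-central m)
... | odd m = trans (f-odd (2 + m * 2) m) (cong (2 *_) (sumC-central m))

-- Katona's theorem

slice : Bool → List (Vec Bool (suc n)) → List (Vec Bool n)
slice b [] = []
slice false ((false ∷ x) ∷ F) = x ∷ slice false F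
slice false ((true ∷ _) ∷ F) = slice false F
slice true ((false ∷ _) ∷ F) = slice true F
slice true ((true ∷ x) ∷ F) = x ∷ slice true F

∈-slice : ∀ b {F : List (Vec Bool (suc n))} {x} → x ∈ slice b F → (b ∷ x) ∈ F
∈-slice false {(false ∷ _) ∷ F} (here refl) = here refl
∈-slice false {(false ∷ _) ∷ F} (there x∈) = there (∈-slice false x∈)
∈-slice false {(true ∷ _) ∷ F} x∈ = there (∈-slice false x∈)
∈-slice true {(false ∷ _) ∷ F} x∈ = there (∈-slice true x∈)
∈-slice true {(true ∷ _) ∷ F} (here refl) = here refl
∈-slice true {(true ∷ _) ∷ F} (there x∈) = there (∈-slice true x∈)

slice-unique : ∀ b {F : List (Vec Bool (suc n))} → Unique F → Unique (slice b F)
slice-unique b {[]} [] = []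
slice-unique false {(false ∷ x) ∷ F} (x∉ ∷ u) =
  All.tabulate (λ y∈ x≡y → All.lookup x∉ (∈-slice false y∈) (cong (false ∷_) x≡y)) ∷ slice-unique false u
slice-unique false {(true ∷ _) ∷ F} (_ ∷ u) = slice-unique false u
slice-unique true {(false ∷ _) ∷ F} (_ ∷ u) = slice-unique true u
slice-unique true {(true ∷ x) ∷ F} (x∉ ∷ u) =
  All.tabulate (λ y∈ x≡y → All.lookup x∉ (∈-slice true y∈) (cong (true ∷_) x≡y)) ∷ slice-unique true u

length-slices : (F : List (Vec Bool (suc n))) → length F ≡ length (slice false F) + length (slice true F)
length-slices [] = refl
length-slices ((false ∷ _) ∷ F) = cong suc (length-slices F)
length-slices ((true ∷ _) ∷ F) = trans (cong suc (length-slices F)) (sym (+-suc _ _))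

unique-length-≤ : (F : List (Vec Bool n)) → Unique F → length F ≤ 2 ^ n
unique-length-≤ {zero} [] _ = z≤n
unique-length-≤ {zero} ([] ∷ []) _ = ≤-refl
unique-length-≤ {zero} ([] ∷ [] ∷ _) ((≢[] All.∷ _) ∷ _) = ⊥-elim (≢[] refl)
unique-length-≤ {suc n} F u = begin
  length F                                        ≡⟨ length-slices F ⟩
  length (slice false F) + length (slice true F)  ≤⟨ +-mono-≤ (bound false) (bound true) ⟩
  2 ^ n + 2 ^ n                                   ≡⟨ cong (_+_ (2 ^ n)) (sym (+-identityʳ _)) ⟩
  2 ^ suc n                                       ∎
  where
  open ≤-Reasoning
  bound : ∀ b → length (slice b F) ≤ 2 ^ n
  bound b = unique-length-≤ (slice b F) (slice-unique b u)

complement : Vec Bool n → Vec Bool n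
complement = Vec.map not

complement-involutive : (x : Vec Bool n) → complement (complement x) ≡ x
complement-involutive [] = refl
complement-involutive (a ∷ x) = cong₂ _∷_ (not-involutive a) (complement-involutive x)

unionSize-complement : (x : Vec Bool n) → unionSize x (complement x) ≡ n
unionSize-complement [] = refl
unionSize-complement (a ∷ x) = cong₂ _+_ (cong bit (∨-inverseʳ a)) (unionSize-complement x)

-- F and its complements are disjoint, because a vector and its complement cover all n + 1 coordinates.
antipodal-bound : (F : List (Vec Bool (suc n))) → Unique F → Clique (UnionAtMost n) F → length F ≤ 2 ^ n
antipodal-bound {n} F uF cF = *-cancelˡ-≤ 2 (begin
  2 * length F                         ≡⟨ cong (_+_ (length F)) (+-identityʳ _) ⟩
  length F + length F                  ≡⟨ cong (_+_ (length F)) (sym (length-map complement F)) ⟩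
  length F + length (map complement F) ≡⟨ sym (length-++ F) ⟩
  length (F ++ map complement F)       ≤⟨ unique-length-≤ _ (Unique.++⁺ uF uF̄ disjoint) ⟩
  2 * 2 ^ n                            ∎)
  where
  open ≤-Reasoning
  uF̄ : Unique (map complement F)
  uF̄ = Unique.map⁺ (λ {x} {y} x̄≡ȳ → trans (sym (complement-involutive x))
                     (trans (cong complement x̄≡ȳ) (complement-involutive y))) uF
  disjoint : Disjoint F (map complement F)
  disjoint (v∈ , v̄∈) with ∈-map⁻ complement v̄∈
  ... | x , x∈ , refl = <⇒≱ (n<1+n n) (subst (_≤ n) (unionSize-complement x) (cF x∈ v∈))

shift : Fin n → Vec Bool (suc n) → Vec Bool (suc n)
shift q (false ∷ x) = false ∷ x
shift q (true ∷ x) = if lookup x q then true ∷ x else false ∷ (x [ q ]≔ true)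

shift-free : ∀ (q : Fin n) x → lookup x q ≡ false → shift q (true ∷ x) ≡ false ∷ (x [ q ]≔ true)
shift-free q x x[q]≡false = cong (λ b → if b then true ∷ x else false ∷ (x [ q ]≔ true)) x[q]≡false

shift-moved : ∀ (q : Fin n) v → shift q v ≢ v → ∃ λ x → v ≡ true ∷ x × lookup x q ≡ false
shift-moved q (false ∷ x) moved = ⊥-elim (moved refl)
shift-moved q (true ∷ x) moved with lookup x q in x[q]≡
... | true = ⊥-elim (moved refl)
... | false = x , refl , x[q]≡

shift-decreasing : ∀ (q : Fin n) v → shift q v ≢ v → bit (Vec.head (shift q v)) < bit (Vec.head v)
shift-decreasing q v moved with shift-moved q v moved
... | x , refl , x[q]≡false rewrite shift-free q x x[q]≡false = ≤-refl

shift-injective-on-moved : ∀ (q : Fin n) {v w} →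
  shift q v ≡ shift q w → shift q v ≢ v → shift q w ≢ w → v ≡ w
shift-injective-on-moved q {v} {w} same v-moved w-moved with shift-moved q v v-moved | shift-moved q w w-moved
... | x , refl , x[q]≡false | y , refl , y[q]≡false = cong (true ∷_) (begin
  x                            ≡⟨ sym ([]≔-restore x q x[q]≡false) ⟩
  (x [ q ]≔ true) [ q ]≔ false ≡⟨ cong (_[ q ]≔ false) set-equal ⟩
  (y [ q ]≔ true) [ q ]≔ false ≡⟨ []≔-restore y q y[q]≡false ⟩
  y                            ∎)
  where
  open ≡-Reasoning
  set-equal : x [ q ]≔ true ≡ y [ q ]≔ true
  set-equal = ∷-injectiveʳ (trans (sym (shift-free q x x[q]≡false)) (trans same (shift-free q y y[q]≡false)))

unionSize-set-≤ : ∀ (x y : Vec Bool n) q → unionSize (x [ q ]≔ true) y ≤ suc (unionSize x y)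
unionSize-set-≤ (a ∷ x) (b ∷ y) zero = s≤s (m≤n+m (unionSize x y) (bit (a ∨ b)))
unionSize-set-≤ (a ∷ x) (b ∷ y) (suc q) =
  ≤-trans (+-monoʳ-≤ (bit (a ∨ b)) (unionSize-set-≤ x y q)) (≤-reflexive (+-suc _ _))

unionSize-set-covered : ∀ (x y : Vec Bool n) q → lookup y q ≡ true → unionSize (x [ q ]≔ true) y ≡ unionSize x y
unionSize-set-covered (false ∷ x) (true ∷ y) zero refl = refl
unionSize-set-covered (true ∷ x) (true ∷ y) zero refl = refl
unionSize-set-covered (a ∷ x) (b ∷ y) (suc q) y[q]≡true =
  cong (_+_ (bit (a ∨ b))) (unionSize-set-covered x y q y[q]≡true)

unionSize-set-fresh : ∀ (x y : Vec Bool n) q → lookup x q ≡ false → lookup y q ≡ false →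
  unionSize (x [ q ]≔ true) y ≡ suc (unionSize x y)
unionSize-set-fresh (false ∷ x) (false ∷ y) zero refl refl = refl
unionSize-set-fresh (a ∷ x) (b ∷ y) (suc q) x[q]≡false y[q]≡false =
  trans (cong (_+_ (bit (a ∨ b))) (unionSize-set-fresh x y q x[q]≡false y[q]≡false)) (+-suc _ _)

unionSize-set-freshʳ : ∀ (x y : Vec Bool n) q → lookup x q ≡ false → lookup y q ≡ false →
  unionSize x (y [ q ]≔ true) ≡ suc (unionSize x y)
unionSize-set-freshʳ x y q x[q]≡false y[q]≡false = begin
  unionSize x (y [ q ]≔ true) ≡⟨ unionSize-comm x _ ⟩
  unionSize (y [ q ]≔ true) x ≡⟨ unionSize-set-fresh y x q y[q]≡false x[q]≡false ⟩
  suc (unionSize y x)         ≡⟨ cong suc (unionSize-comm y x) ⟩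
  suc (unionSize x y)         ∎
  where open ≡-Reasoning

unionSize-shift-moved : ∀ (q : Fin n) {v w} → shift q v ≢ v → shift q w ≢ w →
  unionSize (shift q v) (shift q w) ≡ unionSize v w
unionSize-shift-moved q {v} {w} v-moved w-moved with shift-moved q v v-moved | shift-moved q w w-moved
... | x , refl , x[q]≡false | y , refl , y[q]≡false
  rewrite shift-free q x x[q]≡false | shift-free q y y[q]≡false = begin
  unionSize (x [ q ]≔ true) (y [ q ]≔ true) ≡⟨ unionSize-set-covered x _ q (lookup∘update q y true) ⟩
  unionSize x (y [ q ]≔ true)               ≡⟨ unionSize-set-freshʳ x y q x[q]≡false y[q]≡false ⟩
  suc (unionSize x y)                       ∎
  where open ≡-Reasoning

unionAtMost-shift-fixed : ∀ (q : Fin n) {v w} → shift q v ≢ v →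
  UnionAtMost d v w → UnionAtMost d v (shift q w) → UnionAtMost d (shift q v) w
unionAtMost-shift-fixed {d = d} q {v} {w} v-moved v∪w≤d v∪sw≤d with shift-moved q v v-moved
... | x , refl , x[q]≡false rewrite shift-free q x x[q]≡false with w
... | false ∷ y = ≤-trans (unionSize-set-≤ x y q) v∪w≤d
... | true ∷ y with lookup y q in y[q]≡
...   | true = subst (_≤ d) (cong suc (sym (unionSize-set-covered x y q y[q]≡))) v∪w≤d
...   | false = subst (_≤ d) (cong suc (trans (unionSize-set-freshʳ x y q x[q]≡false y[q]≡)
                                              (sym (unionSize-set-fresh x y q x[q]≡false y[q]≡)))) v∪sw≤d

module Shifting {n} = Compression (≡-dec _≟ᵇ_) (shift {n}) shift-injective-on-moved (bit ∘ Vec.head) shift-decreasing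

common-zero : (x y : Vec Bool n) → unionSize x y < n → ∃ λ q → lookup x q ≡ false × lookup y q ≡ false
common-zero (false ∷ x) (false ∷ y) _ = zero , refl , refl
common-zero (false ∷ x) (true ∷ y) (s≤s x∪y<n) with common-zero x y x∪y<n
... | q , x[q]≡false , y[q]≡false = suc q , x[q]≡false , y[q]≡false
common-zero (true ∷ x) (b ∷ y) (s≤s x∪y<n) with common-zero x y x∪y<n
... | q , x[q]≡false , y[q]≡false = suc q , x[q]≡false , y[q]≡false

-- Two members of the top slice miss a common coordinate q, and shifting one of them into q costs 2.
top-slice-union : (G : List (Vec Bool (suc n))) → Shifting.Stable G → d < n → Clique (UnionAtMost d) G →
  Clique (λ x y → 2 + unionSize x y ≤ d) (slice true G)
top-slice-union {d = d} G stable d<n cG {x} {y} x∈ y∈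
  with common-zero x y (≤-trans (cG (∈-slice true x∈) (∈-slice true y∈)) (<⇒≤ d<n))
... | q , x[q]≡false , y[q]≡false =
  subst (_≤ d) (cong suc (unionSize-set-freshʳ x y q x[q]≡false y[q]≡false)) (cG (∈-slice true x∈) shifted-y∈)
  where
  shifted-y∈ : (false ∷ (y [ q ]≔ true)) ∈ G
  shifted-y∈ = subst (_∈ G) (shift-free q y y[q]≡false) (All.lookup (stable q) (∈-slice true y∈))

katona : ∀ {n} d → d < n → (F : List (Vec Bool n)) →
  Unique F → Clique (UnionAtMost d) F → length F ≤ f n d
katona {suc n} d d<1+n F uF cF with m≤n⇒m<n∨m≡n (≤-pred d<1+n)
... | inj₂ refl = subst (length F ≤_) (sym (f-diagonal n)) (antipodal-bound F uF cF)
... | inj₁ d<n with Shifting.stabilise (UnionAtMost d) (λ {x} {y} → subst (_≤ d) (unionSize-comm x y))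
                      (λ q v-moved w-moved → subst (_≤ d) (sym (unionSize-shift-moved q v-moved w-moved)))
                      unionAtMost-shift-fixed F uF cF
...   | G , stable , uG , cG , |G|≡|F| = subst (_≤ f (suc n) d) |G|≡|F| (begin
  length G                                       ≡⟨ length-slices G ⟩
  length (slice false G) + length (slice true G) ≤⟨ +-monoˡ-≤ _ (katona d d<n (slice false G) (slice-unique false uG)
                                                      (λ x∈ y∈ → cG (∈-slice false x∈) (∈-slice false y∈))) ⟩
  f n d + length (slice true G)                  ≤⟨ top-bound d d<n (slice true G) (slice-unique true uG)
                                                      (top-slice-union G stable d<n cG) ⟩
  f (suc n) d                                    ∎)
  where
  open ≤-Reasoning
  top-bound : ∀ d → d < n → (H : List (Vec Bool n)) → Unique H →
    Clique (λ x y → 2 + unionSize x y ≤ d) H → f n d + length H ≤ f (suc n) d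
  top-bound 0 _ [] _ _ = ≤-refl
  top-bound 1 _ [] _ _ = ≤-refl
  top-bound 0 _ (x ∷ _) _ cH with cH (here refl) (here refl)
  ... | ()
  top-bound 1 _ (x ∷ _) _ cH with cH (here refl) (here refl)
  ... | s≤s ()
  top-bound (suc (suc d)) 3+d≤n H uH cH = begin
    f n (2 + d) + length H ≤⟨ +-monoʳ-≤ _ (katona d (m+n≤o⇒n≤o 2 3+d≤n) H uH
                                (λ x∈ y∈ → ≤-pred (≤-pred (cH x∈ y∈)))) ⟩
    f n (2 + d) + f n d   ≡⟨ f-pascal d (≤-trans (s≤s z≤n) 3+d≤n) ⟩
    f (suc n) (2 + d)     ∎

-- Kleitman's theorem

clear : Fin n → Vec Bool n → Vec Bool n
clear i x = x [ i ]≔ false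

clear-moved : ∀ (i : Fin n) x → clear i x ≢ x → lookup x i ≡ true
clear-moved i x moved with lookup x i in x[i]≡
... | true = refl
... | false = ⊥-elim (moved (trans (cong (x [ i ]≔_) (sym x[i]≡)) ([]≔-lookup x i)))

clear-injective-on-moved : ∀ (i : Fin n) {x y} →
  clear i x ≡ clear i y → clear i x ≢ x → clear i y ≢ y → x ≡ y
clear-injective-on-moved i {x} {y} same x-moved y-moved = begin
  x                       ≡⟨ sym ([]≔-restore x i (clear-moved i x x-moved)) ⟩
  clear i x [ i ]≔ true   ≡⟨ cong (_[ i ]≔ true) same ⟩
  clear i y [ i ]≔ true   ≡⟨ []≔-restore y i (clear-moved i y y-moved) ⟩
  y                       ∎
  where open ≡-Reasoning

ones-clear : ∀ (x : Vec Bool n) i → lookup x i ≡ true → suc (ones (clear i x)) ≡ ones x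
ones-clear (true ∷ x) zero refl = refl
ones-clear (a ∷ x) (suc i) x[i]≡true = trans (sym (+-suc (bit a) _)) (cong (_+_ (bit a)) (ones-clear x i x[i]≡true))

clear-decreasing : ∀ (i : Fin n) x → clear i x ≢ x → ones (clear i x) < ones x
clear-decreasing i x moved = ≤-reflexive (ones-clear x i (clear-moved i x moved))

distance-clear-both : ∀ (x y : Vec Bool n) i → distance (clear i x) (clear i y) ≤ distance x y
distance-clear-both (a ∷ x) (b ∷ y) zero = +-monoˡ-≤ (distance x y) z≤n
distance-clear-both (a ∷ x) (b ∷ y) (suc i) = +-monoʳ-≤ (bit (a xor b)) (distance-clear-both x y i)

distance-clearˡ : ∀ (x y : Vec Bool n) i → lookup y i ≡ false → distance (clear i x) y ≤ distance x y
distance-clearˡ (a ∷ x) (false ∷ y) zero refl = +-monoˡ-≤ (distance x y) z≤n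
distance-clearˡ (a ∷ x) (b ∷ y) (suc i) y[i]≡false =
  +-monoʳ-≤ (bit (a xor b)) (distance-clearˡ x y i y[i]≡false)

distance-clear-swap : ∀ (x y : Vec Bool n) i → lookup x i ≡ true → lookup y i ≡ true →
  distance (clear i x) y ≡ distance x (clear i y)
distance-clear-swap (true ∷ x) (true ∷ y) zero refl refl = refl
distance-clear-swap (a ∷ x) (b ∷ y) (suc i) x[i]≡true y[i]≡true =
  cong (_+_ (bit (a xor b))) (distance-clear-swap x y i x[i]≡true y[i]≡true)

module Clearing {n} = Compression (≡-dec _≟ᵇ_) (clear {n}) clear-injective-on-moved ones clear-decreasing

distanceAtMost-clear-fixed : ∀ (i : Fin n) {x y} → clear i x ≢ x →
  DistanceAtMost d x y → DistanceAtMost d x (clear i y) → DistanceAtMost d (clear i x) y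
distanceAtMost-clear-fixed {d = d} i {x} {y} x-moved x-y≤d x-y′≤d with lookup y i in y[i]≡
... | false = ≤-trans (distance-clearˡ x y i y[i]≡) x-y≤d
... | true = subst (_≤ d) (sym (distance-clear-swap x y i (clear-moved i x x-moved) y[i]≡)) x-y′≤d

_⊑_ : Vec Bool n → Vec Bool n → Set
_⊑_ = Pointwise Bool._≤_

_∖_ : Vec Bool n → Vec Bool n → Vec Bool n
[] ∖ [] = []
(b ∷ y) ∖ (a ∷ x) = (b ∧ not a) ∷ (y ∖ x)

∖-⊑ : (y x : Vec Bool n) → (y ∖ x) ⊑ y
∖-⊑ [] [] = []
∖-⊑ (false ∷ y) (a ∷ x) = b≤b ∷ ∖-⊑ y x
∖-⊑ (true ∷ y) (false ∷ x) = b≤b ∷ ∖-⊑ y x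
∖-⊑ (true ∷ y) (true ∷ x) = f≤t ∷ ∖-⊑ y x

unionSize≡distance-∖ : (x y : Vec Bool n) → unionSize x y ≡ distance x (y ∖ x)
unionSize≡distance-∖ [] [] = refl
unionSize≡distance-∖ (a ∷ x) (b ∷ y) = cong₂ _+_ (cong bit (∨≡xor-∧not a b)) (unionSize≡distance-∖ x y)
  where
  ∨≡xor-∧not : ∀ a b → a ∨ b ≡ a xor (b ∧ not a)
  ∨≡xor-∧not false false = refl
  ∨≡xor-∧not false true = refl
  ∨≡xor-∧not true false = refl
  ∨≡xor-∧not true true = refl

distance-∷-same : ∀ b (x y : Vec Bool n) → distance (b ∷ x) (b ∷ y) ≡ distance x y
distance-∷-same b x y = cong (λ c → bit c + distance x y) (xor-same b)

⊑-distance-zero : {z y : Vec Bool n} → z ⊑ y → distance z y ≡ 0 → z ≡ y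
⊑-distance-zero [] _ = refl
⊑-distance-zero {z = b ∷ z} {b ∷ y} (b≤b ∷ z⊑y) z-y≡0 =
  cong (b ∷_) (⊑-distance-zero z⊑y (trans (sym (distance-∷-same b z y)) z-y≡0))

⊑-clear-step : {z y : Vec Bool n} → z ⊑ y → distance z y ≡ suc k →
  ∃ λ i → z ⊑ clear i y × distance z (clear i y) ≡ k
⊑-clear-step (f≤t ∷ z⊑y) z-y≡1+k = zero , b≤b ∷ z⊑y , suc-injective z-y≡1+k
⊑-clear-step {z = b ∷ z} {b ∷ y} (b≤b ∷ z⊑y) z-y≡1+k
  with ⊑-clear-step z⊑y (trans (sym (distance-∷-same b z y)) z-y≡1+k)
... | i , z⊑y′ , z-y′≡k = suc i , b≤b ∷ z⊑y′ , trans (distance-∷-same b z _) z-y′≡k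

downClosed-⊑ : {F : List (Vec Bool n)} → Clearing.Stable F → ∀ {y z} → y ∈ F → z ⊑ y → z ∈ F
downClosed-⊑ {F = F} stable y∈ z⊑y = go _ refl y∈ z⊑y
  where
  go : ∀ k {y z} → distance z y ≡ k → y ∈ F → z ⊑ y → z ∈ F
  go zero z-y≡0 y∈ z⊑y = subst (_∈ F) (sym (⊑-distance-zero z⊑y z-y≡0)) y∈
  go (suc k) z-y≡1+k y∈ z⊑y with ⊑-clear-step z⊑y z-y≡1+k
  ... | i , z⊑y′ , z-y′≡k = go k z-y′≡k (All.lookup (stable i) y∈) z⊑y′

-- In a down-closed family y ∖ x is a member, and its distance to x is |x ∪ y|.
downClosed-union : {F : List (Vec Bool n)} → Clearing.Stable F →
  Clique (DistanceAtMost d) F → Clique (UnionAtMost d) F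
downClosed-union {d = d} stable cF {x} {y} x∈ y∈ =
  subst (_≤ d) (sym (unionSize≡distance-∖ x y)) (cF x∈ (downClosed-⊑ stable y∈ (∖-⊑ y x)))

kleitman : ∀ {n} d → d < n → (F : List (Vec Bool n)) →
  Unique F → Clique (DistanceAtMost d) F → length F ≤ f n d
kleitman d d<n F uF cF
  with Clearing.stabilise (DistanceAtMost d) (λ {x} {y} → subst (_≤ d) (distance-comm x y))
         (λ i {x} {y} _ _ → ≤-trans (distance-clear-both x y i)) distanceAtMost-clear-fixed F uF cF
... | G , stable , uG , cG , |G|≡|F| =
  subst (_≤ f _ d) |G|≡|F| (katona d d<n G uG (downClosed-union stable cG))

-- Extremal families

byHead : List (Vec Bool n) → List (Vec Bool n) → List (Vec Bool (suc n))
byHead A B = map (false ∷_) A ++ map (true ∷_) B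

length-byHead : (A B : List (Vec Bool n)) → length (byHead A B) ≡ length A + length B
length-byHead A B = trans (length-++ (map (false ∷_) A)) (cong₂ _+_ (length-map _ A) (length-map _ B))

byHead-unique : {A B : List (Vec Bool n)} → Unique A → Unique B → Unique (byHead A B)
byHead-unique uA uB = Unique.++⁺ (Unique.map⁺ ∷-injectiveʳ uA) (Unique.map⁺ ∷-injectiveʳ uB) disjoint
  where
  disjoint : Disjoint (map (false ∷_) _) (map (true ∷_) _)
  disjoint (v∈ , v∈′) with ∈-map⁻ (false ∷_) v∈ | ∈-map⁻ (true ∷_) v∈′
  ... | _ , _ , refl | _ , _ , ()

∈-byHead⁻ : (A B : List (Vec Bool n)) {v : Vec Bool (suc n)} → v ∈ byHead A B →
  (∃ λ x → x ∈ A × v ≡ false ∷ x) ⊎ (∃ λ x → x ∈ B × v ≡ true ∷ x)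
∈-byHead⁻ A B v∈ with ∈-++⁻ (map (false ∷_) A) v∈
... | inj₁ v∈₀ = inj₁ (∈-map⁻ (false ∷_) v∈₀)
... | inj₂ v∈₁ = inj₂ (∈-map⁻ (true ∷_) v∈₁)

ball : ∀ n → ℕ → List (Vec Bool n)
ball zero m = [] ∷ []
ball (suc n) zero = byHead (ball n zero) []
ball (suc n) (suc m) = byHead (ball n (suc m)) (ball n m)

sumC-zero : ∀ m → sumC 0 m ≡ 1
sumC-zero zero = refl
sumC-zero (suc m) = trans (+-identityʳ _) (sumC-zero m)

length-ball : ∀ n m → length (ball n m) ≡ sumC n m
length-ball zero m = sym (sumC-zero m)
length-ball (suc n) zero = trans (length-byHead (ball n zero) []) (trans (+-identityʳ _) (length-ball n zero))
length-ball (suc n) (suc m) = begin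
  length (byHead (ball n (suc m)) (ball n m)) ≡⟨ length-byHead (ball n (suc m)) (ball n m) ⟩
  length (ball n (suc m)) + length (ball n m) ≡⟨ cong₂ _+_ (length-ball n (suc m)) (length-ball n m) ⟩
  sumC n (suc m) + sumC n m                   ≡⟨ sym (sumC-pascal n m) ⟩
  sumC (suc n) (suc m)                        ∎
  where open ≡-Reasoning

ball-unique : ∀ n m → Unique (ball n m)
ball-unique zero m = All.[] ∷ []
ball-unique (suc n) zero = byHead-unique (ball-unique n zero) []
ball-unique (suc n) (suc m) = byHead-unique (ball-unique n (suc m)) (ball-unique n m)

ball-ones : ∀ n m {x} → x ∈ ball n m → ones x ≤ m
ball-ones zero m (here refl) = z≤n
ball-ones (suc n) zero x∈ with ∈-byHead⁻ (ball n zero) [] x∈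
... | inj₁ (y , y∈ , refl) = ball-ones n zero y∈
... | inj₂ (y , () , _)
ball-ones (suc n) (suc m) x∈ with ∈-byHead⁻ (ball n (suc m)) (ball n m) x∈
... | inj₁ (y , y∈ , refl) = ball-ones n (suc m) y∈
... | inj₂ (y , y∈ , refl) = s≤s (ball-ones n m y∈)

distance-≤-ones : (x y : Vec Bool n) → distance x y ≤ ones x + ones y
distance-≤-ones [] [] = z≤n
distance-≤-ones (a ∷ x) (b ∷ y) = begin
  bit (a xor b) + distance x y     ≤⟨ +-mono-≤ (bit-xor-≤ a b) (distance-≤-ones x y) ⟩
  (bit a + bit b) + (ones x + ones y) ≡⟨ interchange (bit a) (bit b) (ones x) (ones y) ⟩
  (bit a + ones x) + (bit b + ones y) ∎
  where
  open ≤-Reasoning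
  bit-xor-≤ : ∀ a b → bit (a xor b) ≤ bit a + bit b
  bit-xor-≤ false b = ≤-refl
  bit-xor-≤ true false = ≤-refl
  bit-xor-≤ true true = z≤n
  interchange : ∀ p q r s → (p + q) + (r + s) ≡ (p + r) + (q + s)
  interchange = ℕ-Ring.solve-∀

ball-diameter : ∀ n m → Clique (DistanceAtMost (m * 2)) (ball n m)
ball-diameter n m {x} {y} x∈ y∈ = begin
  distance x y    ≤⟨ distance-≤-ones x y ⟩
  ones x + ones y ≤⟨ +-mono-≤ (ball-ones n m x∈) (ball-ones n m y∈) ⟩
  m + m           ≡⟨ sym (m*2≡m+m m) ⟩
  m * 2           ∎
  where open ≤-Reasoning

cylinder-diameter : ∀ n m → Clique (DistanceAtMost (suc (m * 2))) (byHead (ball n m) (ball n m))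
cylinder-diameter n m v∈ w∈ with member v∈ | member w∈
  where
  member : ∀ {v} → v ∈ byHead (ball n m) (ball n m) → ∃₂ λ b x → v ≡ b ∷ x × x ∈ ball n m
  member v∈ with ∈-byHead⁻ (ball n m) (ball n m) v∈
  ... | inj₁ (x , x∈ , v≡) = false , x , v≡ , x∈
  ... | inj₂ (x , x∈ , v≡) = true , x , v≡ , x∈
... | a , x , refl , x∈ | b , y , refl , y∈ = +-mono-≤ (bit-≤-1 (a xor b)) (ball-diameter n m x∈ y∈)
  where
  bit-≤-1 : ∀ c → bit c ≤ 1
  bit-≤-1 false = z≤n
  bit-≤-1 true = ≤-refl

optimal-family : ∀ {n} r → r < n →
  Σ[ B ∈ List (Vec Bool n) ] Unique B × Clique (DistanceAtMost r) B × length B ≡ f n r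
optimal-family r r<n with parity r
optimal-family {n} _ _ | even m =
  ball n m , ball-unique n m , ball-diameter n m , trans (length-ball n m) (sym (f-even n m))
optimal-family {suc n} _ _ | odd m =
  byHead (ball n m) (ball n m) ,
  byHead-unique (ball-unique n m) (ball-unique n m) ,
  cylinder-diameter n m ,
  (begin
    length (byHead (ball n m) (ball n m)) ≡⟨ length-byHead (ball n m) (ball n m) ⟩
    length (ball n m) + length (ball n m) ≡⟨ cong (λ k → k + k) (length-ball n m) ⟩
    sumC n m + sumC n m                   ≡⟨ cong (_+_ (sumC n m)) (sym (+-identityʳ _)) ⟩
    2 * sumC n m                          ≡⟨ sym (f-odd (suc n) m) ⟩
    f (suc n) (suc (m * 2))               ∎)
  where open ≡-Reasoning

-- Full-weight vectors

signed : Bool → Trit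
signed false = neg
signed true = pos

isPos : Trit → Bool
isPos pos = true
isPos _ = false

fromBits : Vec Bool n → Vec Trit n
fromBits = Vec.map signed

toBits : Vec Trit n → Vec Bool n
toBits = Vec.map isPos

toBits-fromBits : (x : Vec Bool n) → toBits (fromBits x) ≡ x
toBits-fromBits [] = refl
toBits-fromBits (false ∷ x) = cong (false ∷_) (toBits-fromBits x)
toBits-fromBits (true ∷ x) = cong (true ∷_) (toBits-fromBits x)

weight-fromBits : (x : Vec Bool n) → weight (fromBits x) ≡ n
weight-fromBits [] = refl
weight-fromBits (false ∷ x) = cong suc (weight-fromBits x)
weight-fromBits (true ∷ x) = cong suc (weight-fromBits x)

weight-≤ : (v : Vec Trit n) → weight v ≤ n
weight-≤ [] = z≤n
weight-≤ (neg ∷ v) = s≤s (weight-≤ v)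
weight-≤ (zer ∷ v) = m≤n⇒m≤1+n (weight-≤ v)
weight-≤ (pos ∷ v) = s≤s (weight-≤ v)

fromBits-toBits : (v : Vec Trit n) → weight v ≡ n → fromBits (toBits v) ≡ v
fromBits-toBits [] _ = refl
fromBits-toBits (neg ∷ v) full = cong (neg ∷_) (fromBits-toBits v (suc-injective full))
fromBits-toBits (zer ∷ v) full = ⊥-elim (<⇒≢ (s≤s (weight-≤ v)) full)
fromBits-toBits (pos ∷ v) full = cong (pos ∷_) (fromBits-toBits v (suc-injective full))

1ℤ+m⊖n≡1+m⊖n : ∀ m n → 1ℤ ℤ.+ (m ⊖ n) ≡ suc m ⊖ n
1ℤ+m⊖n≡1+m⊖n m n = ℤ.distribʳ-⊖-+-pos 1 m n

-1ℤ+m⊖n≡1+m⊖2+n : ∀ m n → -1ℤ ℤ.+ (m ⊖ n) ≡ suc m ⊖ suc (suc n)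
-1ℤ+m⊖n≡1+m⊖2+n m n = trans (ℤ.distribʳ-⊖-+-neg 0 m n) (sym (ℤ.[1+m]⊖[1+n]≡m⊖n m (suc n)))

dot-fromBits : (x y : Vec Bool n) → dot (fromBits x) (fromBits y) ≡ n ⊖ distance x y * 2
dot-fromBits [] [] = refl
dot-fromBits {suc n} (false ∷ x) (false ∷ y) =
  trans (cong (ℤ._+_ 1ℤ) (dot-fromBits x y)) (1ℤ+m⊖n≡1+m⊖n n (distance x y * 2))
dot-fromBits {suc n} (true ∷ x) (true ∷ y) =
  trans (cong (ℤ._+_ 1ℤ) (dot-fromBits x y)) (1ℤ+m⊖n≡1+m⊖n n (distance x y * 2))
dot-fromBits {suc n} (false ∷ x) (true ∷ y) =
  trans (cong (ℤ._+_ -1ℤ) (dot-fromBits x y)) (-1ℤ+m⊖n≡1+m⊖2+n n (distance x y * 2))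
dot-fromBits {suc n} (true ∷ x) (false ∷ y) =
  trans (cong (ℤ._+_ -1ℤ) (dot-fromBits x y)) (-1ℤ+m⊖n≡1+m⊖2+n n (distance x y * 2))

-- The levels n ⊖ D * 2 are 2 apart, so any e ≤ 1 gives the same threshold.
level-≤-⊖⇔ : ∀ n {r e} D → e ≤ 1 → n ⊖ (r * 2 + e) ℤ.≤ n ⊖ D * 2 ⇔ D ≤ r
level-≤-⊖⇔ n {r} {e} D e≤1 = mk⇔ necessary sufficient
  where
  sufficient : D ≤ r → n ⊖ (r * 2 + e) ℤ.≤ n ⊖ D * 2
  sufficient D≤r = ℤ.⊖-monoʳ-≥-≤ n (≤-trans (*-monoˡ-≤ 2 D≤r) (m≤m+n (r * 2) e))
  necessary : n ⊖ (r * 2 + e) ℤ.≤ n ⊖ D * 2 → D ≤ r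
  necessary level≤ with D ≤? r
  ... | yes D≤r = D≤r
  ... | no D≰r =
    ⊥-elim (ℤ.<⇒≱ (ℤ.⊖-monoʳ->-< n (≤-trans (s≤s r*2+e≤1+r*2) (*-monoˡ-≤ 2 (≰⇒> D≰r)))) level≤)
    where
    r*2+e≤1+r*2 : r * 2 + e ≤ suc (r * 2)
    r*2+e≤1+r*2 = ≤-trans (+-monoʳ-≤ (r * 2) e≤1) (≤-reflexive (+-comm (r * 2) 1))

fromBits-admissible : ∀ {n r e} → e ≤ 1 → {B : List (Vec Bool n)} → Unique B → Clique (DistanceAtMost r) B →
  Admissible n n (n ⊖ (r * 2 + e)) (map fromBits B)
fromBits-admissible {n} e≤1 {B} uB cB =
  Unique.map⁺ fromBits-injective uB ,
  All.map⁺ (All.tabulate λ {x} _ → weight-fromBits x) ,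
  All.map⁺ (All.tabulate λ {x} x∈ → All.map⁺ (All.tabulate λ {y} y∈ →
    subst (_ ℤ.≤_) (sym (dot-fromBits x y)) (Equivalence.from (level-≤-⊖⇔ n _ e≤1) (cB x∈ y∈))))
  where
  fromBits-injective : ∀ {x y : Vec Bool n} → fromBits x ≡ fromBits y → x ≡ y
  fromBits-injective {x} {y} eq = trans (sym (toBits-fromBits x)) (trans (cong toBits eq) (toBits-fromBits y))

toBits-admissible : ∀ {n r e} → e ≤ 1 → {W : List (Vec Trit n)} → Admissible n n (n ⊖ (r * 2 + e)) W →
  Unique (map toBits W) × Clique (DistanceAtMost r) (map toBits W)
toBits-admissible {n} {r} e≤1 {W} (uW , wW , dW) = unique-map⁺ toBits injective uW , clique
  where
  restore : ∀ {v} → v ∈ W → fromBits (toBits v) ≡ v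
  restore v∈ = fromBits-toBits _ (All.lookup wW v∈)
  injective : ∀ {v w} → v ∈ W → w ∈ W → toBits v ≡ toBits w → v ≡ w
  injective v∈ w∈ eq = trans (sym (restore v∈)) (trans (cong fromBits eq) (restore w∈))
  clique : Clique (DistanceAtMost r) (map toBits W)
  clique a∈ b∈ with ∈-map⁻ toBits a∈ | ∈-map⁻ toBits b∈
  ... | v , v∈ , refl | w , w∈ , refl =
    Equivalence.to (level-≤-⊖⇔ n _ e≤1) (subst (_ ℤ.≤_) (dot-fromBits (toBits v) (toBits w))
      (subst₂ (λ v′ w′ → _ ℤ.≤ dot v′ w′) (sym (restore v∈)) (sym (restore w∈))
        (All.lookup (All.lookup dW v∈) w∈)))

isF-full-weight : ∀ {n r e l} → r < n → e ≤ 1 → l ≡ n ⊖ (r * 2 + e) → IsF n n l (f n r)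
isF-full-weight {n} {r} r<n e≤1 refl with optimal-family r r<n
... | B , uB , cB , |B|≡ =
  (map fromBits B , fromBits-admissible e≤1 uB cB , trans (length-map fromBits B) |B|≡) ,
  λ W admissible → let uW′ , cW′ = toBits-admissible e≤1 admissible in
    subst (_≤ f n r) (length-map toBits W) (kleitman r r<n (map toBits W) uW′ cW′)

⊖-as-difference : ∀ n r e → n ⊖ (r * 2 + e) ≡ + n ℤ.- (+ r ℤ.* + 2 ℤ.+ + e)
⊖-as-difference n r e = trans (sym (ℤ.[+m]-[+n]≡m⊖n n (r * 2 + e)))
  (cong (ℤ._-_ (+ n)) (trans (ℤ.pos-+ (r * 2) e) (cong (ℤ._+ + e) (ℤ.pos-* r 2))))

proposition2 : (t : ℕ) (s : ℤ) → 1 ≤ t →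
    ((r : ℕ) → + t ℤ.- s ≡ + r → 0 ℕ.< r → r ℕ.< 2 ℕ.* t →
      IsF (2 ℕ.* t) (2 ℕ.* t) (+ 2 ℤ.* s) (f (2 ℕ.* t) r)
      × IsF (2 ℕ.* t) (2 ℕ.* t) (+ 2 ℤ.* s ℤ.- 1ℤ) (f (2 ℕ.* t) r))
    × ((r : ℕ) → + t ℤ.- s ≡ + r → 0 ℕ.< r → r ℕ.< 2 ℕ.* t ℕ.+ 1 →
      IsF (2 ℕ.* t ℕ.+ 1) (2 ℕ.* t ℕ.+ 1) (+ 2 ℤ.* s) (f (2 ℕ.* t ℕ.+ 1) r)
      × IsF (2 ℕ.* t ℕ.+ 1) (2 ℕ.* t ℕ.+ 1) (+ 2 ℤ.* s ℤ.+ 1ℤ) (f (2 ℕ.* t ℕ.+ 1) r))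
proposition2 t s _ =
  (λ r t-s≡r _ r<n →
    isF-full-weight r<n z≤n (level r 0 2t≡ t-s≡r (even-even (+ t) s)) ,
    isF-full-weight r<n ≤-refl (level r 1 2t≡ t-s≡r (even-odd (+ t) s))) ,
  (λ r t-s≡r _ r<n →
    isF-full-weight r<n ≤-refl (level r 1 2t+1≡ t-s≡r (odd-even (+ t) s)) ,
    isF-full-weight r<n z≤n (level r 0 2t+1≡ t-s≡r (odd-odd (+ t) s)))
  where
  level : ∀ {n N l} r e → + n ≡ N → + t ℤ.- s ≡ + r →
    l ≡ N ℤ.- ((+ t ℤ.- s) ℤ.* + 2 ℤ.+ + e) → l ≡ n ⊖ (r * 2 + e)
  level {n} r e n≡N t-s≡r l≡ =
    trans l≡ (trans (cong₂ (λ a z → a ℤ.- (z ℤ.* + 2 ℤ.+ + e)) (sym n≡N) t-s≡r)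
                    (sym (⊖-as-difference n r e)))
  2t≡ : + (2 ℕ.* t) ≡ + 2 ℤ.* + t
  2t≡ = ℤ.pos-* 2 t
  2t+1≡ : + (2 ℕ.* t ℕ.+ 1) ≡ + 2 ℤ.* + t ℤ.+ 1ℤ
  2t+1≡ = trans (ℤ.pos-+ (2 ℕ.* t) 1) (cong (ℤ._+ 1ℤ) 2t≡)
  even-even : ∀ T S → + 2 ℤ.* S ≡ + 2 ℤ.* T ℤ.- ((T ℤ.- S) ℤ.* + 2 ℤ.+ + 0)
  even-even = ℤ-Ring.solve-∀
  even-odd : ∀ T S → + 2 ℤ.* S ℤ.- 1ℤ ≡ + 2 ℤ.* T ℤ.- ((T ℤ.- S) ℤ.* + 2 ℤ.+ + 1)
  even-odd = ℤ-Ring.solve-∀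
  odd-even : ∀ T S → + 2 ℤ.* S ≡ (+ 2 ℤ.* T ℤ.+ 1ℤ) ℤ.- ((T ℤ.- S) ℤ.* + 2 ℤ.+ + 1)
  odd-even = ℤ-Ring.solve-∀
  odd-odd : ∀ T S → + 2 ℤ.* S ℤ.+ 1ℤ ≡ (+ 2 ℤ.* T ℤ.+ 1ℤ) ℤ.- ((T ℤ.- S) ℤ.* + 2 ℤ.+ + 0)
  odd-odd = ℤ-Ring.solve-∀
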